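{- Every nonempty finite set of negative integers is the signed degree set of some connected signed bipartite graph.
   Context: A bipartite graph $G(U,V)$ is a finite simple graph whose vertex set is partitioned into two nonempty disjoint sets $U$ and $V$ such that every edge joins a vertex of $U$ to a vertex of $V$. A signed bipartite graph is a bipartite graph in which each edge is assigned a sign, positive or negative. The signed degree of a vertex $x$ is the number of positive edges incident with $x$ minus the number of negative edges incident with $x$. The signed degree set of a signed bipartite graph is the set of distinct signed degrees of its vertices. The signed bipartite graph is connected if its underlying graph is connected (every vertex of $U$ is joined by a path to every vertex of $V$). -}

module Defs where

open import Data.Nat using (ℕ)
open import Data.Fin using (Fin)
open import Data.Integer using (ℤ; +_; -_; _+_)
open import Data.Empty using (⊥)
open import Data.Unit using (⊤)
open import Data.Sum using (_⊎_; inj₁; inj₂)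
open import Data.Product using (∃-syntax; _×_)
open import Data.Vec.Functional using (foldr)
open import Relation.Binary.PropositionalEquality using (_≡_)
open import Relation.Binary.Construct.Closure.ReflexiveTransitive using (Star)

-- The status of a pair (u , v) ∈ U × V: no edge, a positive edge, or a negative edge.
-- Since there is at most one status per pair, the underlying graph is simple.
data EdgeSign : Set where
  none pos neg : EdgeSign

val : EdgeSign → ℤ
val none = + 0
val pos  = + 1
val neg  = - (+ 1)

-- A signed bipartite graph with parts U = Fin m and V = Fin n.
-- (Nonemptiness of the parts is imposed where it is used.)
SignedBipartite : ℕ → ℕ → Set
SignedBipartite m n = Fin m → Fin n → EdgeSign

sumFin : {k : ℕ} → (Fin k → ℤ) → ℤ
sumFin f = foldr _+_ (+ 0) f

Vertex : ℕ → ℕ → Set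
Vertex m n = Fin m ⊎ Fin n

signedDegree : {m n : ℕ} → SignedBipartite m n → Vertex m n → ℤ
signedDegree {m} {n} G (inj₁ u) = sumFin (λ v → val (G u v))
signedDegree {m} {n} G (inj₂ v) = sumFin (λ u → val (G u v))

isEdge : EdgeSign → Set
isEdge none = ⊥
isEdge pos  = ⊤
isEdge neg  = ⊤

Adj : {m n : ℕ} → SignedBipartite m n → Vertex m n → Vertex m n → Set
Adj G (inj₁ u) (inj₁ u′) = ⊥
Adj G (inj₁ u) (inj₂ v)  = isEdge (G u v)
Adj G (inj₂ v) (inj₁ u)  = isEdge (G u v)
Adj G (inj₂ v) (inj₂ v′) = ⊥

Connected : {m n : ℕ} → SignedBipartite m n → Set
Connected {m} {n} G = (x y : Vertex m n) → Star (Adj G) x y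

InDegreeSet : {m n : ℕ} → SignedBipartite m n → ℤ → Set
InDegreeSet {m} {n} G d = ∃[ x ] signedDegree G x ≡ d

{-# OPTIONS --safe #-}
module Submission where

-- Write S = { -[1+ k ] ∣ k ∈ K }, let M = max K, let c x be the number of elements of K
-- below x, and put R = c M.  On U = V = {0, …, M} join i and j by a negative edge iff
-- c i + c j ≤ R.  As c is monotone and jumps exactly after the elements of K, whenever
-- c i + c k ≡ R with k ∈ K the neighbours of i are exactly 0, …, k, so i has signed
-- degree -[1+ k ].  Since c takes every value 0, …, R at the elements of K, every vertex
-- has such a partner k and every k ∈ K is the partner of some vertex.  Vertex 0 has
-- c 0 ≡ 0, so it is adjacent to the whole opposite side and the graph is connected.

open import Defs
open import Data.Nat using (ℕ; _≥_)
open import Data.Integer using (ℤ; _<_; +_)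
open import Data.List using (List; [])
open import Data.List.Membership.Propositional using (_∈_)
open import Data.List.Relation.Unary.All using (All)
open import Data.Product using (Σ; ∃-syntax; _×_)
open import Function.Bundles using (_⇔_)
open import Relation.Binary.PropositionalEquality using (_≢_)

open import Data.Nat as ℕ using (zero; suc; z≤n; s≤s; _≤′_; ≤′-refl; ≤′-step)
  renaming (_+_ to _+ℕ_; _≤_ to _≤ℕ_; _<_ to _<ℕ_)
open import Data.Nat.Properties as ℕ using (_≤?_)
open import Data.Integer as ℤ using (-_; -[1+_]; +<+)
open import Data.Integer.Properties as ℤ using (_≟_)
open import Data.Fin using (Fin; zero; toℕ; fromℕ<)
open import Data.Fin.Properties using (toℕ<n; toℕ-fromℕ<)
open import Data.Sum using (inj₁; inj₂)
open import Data.Product using (_,_; map₁; map₂)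
open import Data.Unit using (tt)
open import Data.List using (_∷_)
open import Data.List.Relation.Unary.Any using (here; there)
open import Data.List.Relation.Unary.All as All using ()
open import Data.List.Membership.DecPropositional _≟_ using (_∈?_)
open import Data.List.Extrema ℤ.≤-totalOrder using (min; argmin-all; min≤⊤; min≤xs)
open import Function using (_∘_; id; mk⇔)
open import Function.Properties.Equivalence as ⇔ using ()
open import Relation.Nullary using (Dec; yes; no; ¬_; contradiction)
open import Relation.Unary using (Pred; Decidable)
open import Relation.Binary.PropositionalEquality using (_≡_; refl; sym; trans; cong; cong₂; subst; module ≡-Reasoning)
open import Relation.Binary.Construct.Closure.ReflexiveTransitive using (Star; ε; _◅_; _◅◅_)

negIf : {A : Set} → Dec A → EdgeSign
negIf (yes _) = neg
negIf (no _)  = none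

negIf-yes : {A : Set} (a? : Dec A) → A → negIf a? ≡ neg
negIf-yes (yes _) _ = refl
negIf-yes (no ¬a) a = contradiction a ¬a

negIf-no : {A : Set} (a? : Dec A) → ¬ A → negIf a? ≡ none
negIf-no (yes a) ¬a = contradiction a ¬a
negIf-no (no _)  _  = refl

isEdge-neg : ∀ {e} → e ≡ neg → isEdge e
isEdge-neg refl = tt

module _ {p} {P : Pred ℕ p} (P? : Decidable P) where

  count : ℕ → ℕ
  count zero = zero
  count (suc n) with P? n
  ... | yes _ = suc (count n)
  ... | no _  = count n

  count-≤-suc : ∀ n → count n ≤ℕ count (suc n)
  count-≤-suc n with P? n
  ... | yes _ = ℕ.n≤1+n (count n)
  ... | no _  = ℕ.≤-refl

  count-mono : ∀ {m n} → m ≤ℕ n → count m ≤ℕ count n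
  count-mono = go ∘ ℕ.≤⇒≤′
    where
    go : ∀ {m n} → m ≤′ n → count m ≤ℕ count n
    go ≤′-refl       = ℕ.≤-refl
    go (≤′-step m≤n) = ℕ.≤-trans (go m≤n) (count-≤-suc _)

  count-suc : ∀ {n} → P n → count (suc n) ≡ suc (count n)
  count-suc {n} Pn with P? n
  ... | yes _  = refl
  ... | no ¬Pn = contradiction Pn ¬Pn

  count-attains : ∀ {s} n → s <ℕ count n → ∃[ k ] k <ℕ n × P k × count k ≡ s
  count-attains (suc n) s<c with P? n
  ... | no _ = map₂ (map₁ ℕ.m<n⇒m<1+n) (count-attains n s<c)
  ... | yes Pn with ℕ.m<1+n⇒m<n∨m≡n s<c
  ...   | inj₂ refl = n , ℕ.n<1+n n , Pn , refl
  ...   | inj₁ s<cn = map₂ (map₁ ℕ.m<n⇒m<1+n) (count-attains n s<cn)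

sumFin-negSegment : ∀ {n ℓ} (e : ℕ → EdgeSign) → ℓ ≤ℕ n →
  (∀ {j} → j <ℕ ℓ → e j ≡ neg) → (∀ {j} → ℓ ≤ℕ j → e j ≡ none) →
  sumFin {n} (λ v → val (e (toℕ v))) ≡ - (+ ℓ)
sumFin-negSegment {zero}  {zero}  e z≤n below above = refl
sumFin-negSegment {suc n} {zero}  e z≤n below above =
  cong₂ ℤ._+_ (cong val (above z≤n)) (sumFin-negSegment {n} (e ∘ suc) z≤n (λ ()) (λ _ → above z≤n))
sumFin-negSegment {suc n} {suc ℓ} e (s≤s ℓ≤n) below above = begin
  val (e 0) ℤ.+ sumFin {n} (λ v → val (e (suc (toℕ v))))
    ≡⟨ cong₂ ℤ._+_ (cong val (below (s≤s z≤n)))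
                   (sumFin-negSegment (e ∘ suc) ℓ≤n (below ∘ s≤s) (above ∘ s≤s)) ⟩
  - (+ 1) ℤ.+ - (+ ℓ)
    ≡⟨ sym (ℤ.neg-distrib-+ (+ 1) (+ ℓ)) ⟩
  - (+ suc ℓ) ∎
  where open ≡-Reasoning

connected-if-hubs : ∀ {m n} (G : SignedBipartite (suc m) (suc n)) →
  (∀ v → isEdge (G zero v)) → (∀ u → isEdge (G u zero)) → Connected G
connected-if-hubs G row₀ col₀ x y = toHub x ◅◅ fromHub y
  where
  toHub : ∀ x → Star (Adj G) x (inj₁ zero)
  toHub (inj₁ u) = _◅_ {j = inj₂ zero} (col₀ u) (row₀ zero ◅ ε)
  toHub (inj₂ v) = row₀ v ◅ ε

  fromHub : ∀ y → Star (Adj G) (inj₁ zero) y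
  fromHub (inj₁ u) = _◅_ {j = inj₂ zero} (row₀ zero) (col₀ u ◅ ε)
  fromHub (inj₂ v) = row₀ v ◅ ε

module ThresholdGraph {p} {P : Pred ℕ p} (P? : Decidable P)
                      {M : ℕ} (P[M] : P M) (≤M : ∀ {k} → P k → k ≤ℕ M) where

  c : ℕ → ℕ
  c = count P?

  R : ℕ
  R = c M

  edge : ℕ → ℕ → EdgeSign
  edge i j = negIf (c i +ℕ c j ≤? R)

  G : SignedBipartite (suc M) (suc M)
  G u v = edge (toℕ u) (toℕ v)

  edge-comm : ∀ i j → edge i j ≡ edge j i
  edge-comm i j rewrite ℕ.+-comm (c i) (c j) = refl

  edge-upTo : ∀ i {k j} → c i +ℕ c k ≡ R → j ≤ℕ k → edge i j ≡ neg
  edge-upTo i {k} {j} ci+ck≡R j≤k = negIf-yes (c i +ℕ c j ≤? R) (begin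
    c i +ℕ c j ≤⟨ ℕ.+-monoʳ-≤ (c i) (count-mono P? j≤k) ⟩
    c i +ℕ c k ≡⟨ ci+ck≡R ⟩
    R          ∎)
    where open ℕ.≤-Reasoning

  edge-beyond : ∀ i {k j} → P k → c i +ℕ c k ≡ R → k <ℕ j → edge i j ≡ none
  edge-beyond i {k} {j} Pk ci+ck≡R k<j = negIf-no (c i +ℕ c j ≤? R) (ℕ.<⇒≱ (begin-strict
    R                ≡⟨ sym ci+ck≡R ⟩
    c i +ℕ c k       <⟨ ℕ.+-monoʳ-< (c i) (ℕ.n<1+n (c k)) ⟩
    c i +ℕ suc (c k) ≡⟨ cong (c i +ℕ_) (sym (count-suc P? Pk)) ⟩
    c i +ℕ c (suc k) ≤⟨ ℕ.+-monoʳ-≤ (c i) (count-mono P? k<j) ⟩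
    c i +ℕ c j       ∎))
    where open ℕ.≤-Reasoning

  index : Vertex (suc M) (suc M) → ℕ
  index (inj₁ u) = toℕ u
  index (inj₂ v) = toℕ v

  degree-of-partner : ∀ x {k} → P k → c (index x) +ℕ c k ≡ R → signedDegree G x ≡ -[1+ k ]
  degree-of-partner (inj₁ u) Pk ci+ck≡R =
    sumFin-negSegment (edge (toℕ u)) (s≤s (≤M Pk))
      (edge-upTo (toℕ u) ci+ck≡R ∘ ℕ.m<1+n⇒m≤n)
      (edge-beyond (toℕ u) Pk ci+ck≡R)
  degree-of-partner (inj₂ v) Pk ci+ck≡R =
    sumFin-negSegment (λ i → edge i (toℕ v)) (s≤s (≤M Pk))
      (λ {j} j≤k → trans (edge-comm j (toℕ v)) (edge-upTo (toℕ v) ci+ck≡R (ℕ.m<1+n⇒m≤n j≤k)))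
      (λ {j} k<j → trans (edge-comm j (toℕ v)) (edge-beyond (toℕ v) Pk ci+ck≡R k<j))

  R<c[1+M] : R <ℕ c (suc M)
  R<c[1+M] = subst (R <ℕ_) (sym (count-suc P? P[M])) (ℕ.n<1+n R)

  partner : ∀ x → c x ≤ℕ R → ∃[ k ] k <ℕ suc M × P k × c x +ℕ c k ≡ R
  partner x cx≤R with count-attains P? (suc M) (ℕ.≤-<-trans (ℕ.m∸n≤m R (c x)) R<c[1+M])
  ... | k , k<1+M , Pk , ck≡R∸cx = k , k<1+M , Pk , (begin
    c x +ℕ c k         ≡⟨ cong (c x +ℕ_) ck≡R∸cx ⟩
    c x +ℕ (R ℕ.∸ c x) ≡⟨ ℕ.m+[n∸m]≡n cx≤R ⟩
    R                  ∎)
    where open ≡-Reasoning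

  toℕ≤M : (u : Fin (suc M)) → toℕ u ≤ℕ M
  toℕ≤M u = ℕ.m<1+n⇒m≤n (toℕ<n u)

  index≤M : ∀ x → index x ≤ℕ M
  index≤M (inj₁ u) = toℕ≤M u
  index≤M (inj₂ v) = toℕ≤M v

  degree-set : ∀ d → InDegreeSet G d ⇔ (∃[ k ] P k × d ≡ -[1+ k ])
  degree-set d = mk⇔ to from
    where
    to : InDegreeSet G d → ∃[ k ] P k × d ≡ -[1+ k ]
    to (x , deg≡d) with partner (index x) (count-mono P? (index≤M x))
    ... | k , _ , Pk , eq = k , Pk , trans (sym deg≡d) (degree-of-partner x Pk eq)

    from : (∃[ k ] P k × d ≡ -[1+ k ]) → InDegreeSet G d
    from (k , Pk , refl) with partner k (count-mono P? (≤M Pk))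
    ... | i , i<1+M , _ , ck+ci≡R = inj₁ u , degree-of-partner (inj₁ u) Pk ci+ck≡R
      where
      u : Fin (suc M)
      u = fromℕ< i<1+M
      ci+ck≡R : c (toℕ u) +ℕ c k ≡ R
      ci+ck≡R rewrite toℕ-fromℕ< i<1+M | ℕ.+-comm (c i) (c k) = ck+ci≡R

  connected : Connected G
  connected = connected-if-hubs G
    (λ v → isEdge-neg (hub v))
    (λ u → isEdge-neg (trans (edge-comm (toℕ u) 0) (hub u)))
    where
    hub : (v : Fin (suc M)) → edge 0 (toℕ v) ≡ neg
    hub v = negIf-yes (c 0 +ℕ c (toℕ v) ≤? R) (count-mono P? (toℕ≤M v))

min∈ : ∀ d ds → min d ds ∈ d ∷ ds
min∈ d ds = argmin-all id (here refl) (All.tabulate there)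

min≤ : ∀ d ds → All (min d ds ℤ.≤_) (d ∷ ds)
min≤ d ds = min≤⊤ d ds All.∷ min≤xs d ds

largest-magnitude : (S : List ℤ) → S ≢ [] → All (_< + 0) S →
  ∃[ M ] -[1+ M ] ∈ S × (∀ {k} → -[1+ k ] ∈ S → k ≤ℕ M)
largest-magnitude []       S≢[] _   = contradiction refl S≢[]
largest-magnitude (d ∷ ds) _    S<0 =
  from-minimum (min∈ d ds) (min≤ d ds) (All.lookup S<0 (min∈ d ds))
  where
  from-minimum : ∀ {d₀} → d₀ ∈ d ∷ ds → All (d₀ ℤ.≤_) (d ∷ ds) → d₀ < + 0 →
    ∃[ M ] -[1+ M ] ∈ d ∷ ds × (∀ {k} → -[1+ k ] ∈ d ∷ ds → k ≤ℕ M)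
  from-minimum { -[1+ M ] } d₀∈S d₀≤S _ = M , d₀∈S , ℤ.drop‿-≤- ∘ All.lookup d₀≤S
  from-minimum {+ _}        _    _    (+<+ ())

∈-negatives : ∀ {S} → All (_< + 0) S → ∀ d → d ∈ S ⇔ (∃[ k ] -[1+ k ] ∈ S × d ≡ -[1+ k ])
∈-negatives {S} S<0 d = mk⇔ (λ d∈S → to d∈S (All.lookup S<0 d∈S)) from
  where
  to : ∀ {d} → d ∈ S → d < + 0 → ∃[ k ] -[1+ k ] ∈ S × d ≡ -[1+ k ]
  to { -[1+ k ] } d∈S _ = k , d∈S , refl
  to {+ _}        _   (+<+ ())

  from : (∃[ k ] -[1+ k ] ∈ S × d ≡ -[1+ k ]) → d ∈ S
  from (_ , k∈S , refl) = k∈S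

corollary2p1 : (S : List ℤ) → S ≢ [] → All (λ d → d < + 0) S →
    ∃[ m ] ∃[ n ] (m ≥ 1 × n ≥ 1 × Σ (SignedBipartite m n) (λ G →
      Connected G × ((d : ℤ) → (d ∈ S ⇔ InDegreeSet G d))))
corollary2p1 S S≢[] S<0 with largest-magnitude S S≢[] S<0
... | M , M∈S , ≤M = suc M , suc M , s≤s z≤n , s≤s z≤n , G , connected ,
                     λ d → ⇔.trans (∈-negatives S<0 d) (⇔.sym (degree-set d))
  where open ThresholdGraph (λ k → -[1+ k ] ∈? S) M∈S ≤M
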